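{- Let $n=p_1\cdots p_k$ with $p_1<\cdots<p_k$ odd primes. Let $B\subset\underline{n}$ satisfy $\mathcal{C}^{\pm}(B)$. Then $F_{B^{\pm}}/F_{B^{\mp}}$ is a polynomial. (That is: if $\mathcal{C}^+(B)$ holds then $F_{B^+}/F_{B^- }$ is a polynomial, and if $\mathcal{C}^-(B)$ holds then $F_{B^- }/F_{B^+}$ is a polynomial.)
   Context: For a finite set $C$ of positive integers, $F_C=\prod_{c\in C}(x^c-1)$, with $F_\emptyset=1$. For a positive integer $d$, $\overline{d}=\{h:d\mid h\}$ and $\underline{d}=\{h:h\mid d\}$; for a set $B$, $\underline{B}=\bigcup_{d\in B}\underline{d}$ and $B^{\pm}=\{d\in B:\mu(n/d)=\pm1\}$, where $\mu(d)=(-1)^{\omega(d)}$ for square-free $d$ and $\omega(d)$ is the number of prime factors. $\mathcal{C}^{\pm}(B)$ means: for all $d\in\underline{B}$, $\#(B^{\pm}\cap\overline d)\ge\#(B^{\mp}\cap\overline d)$. -}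

module Defs where

open import Data.Nat using (ℕ; zero; suc; _≤_; _<_)
open import Data.Nat.DivMod using (_/_)
open import Data.Nat.Divisibility using (_∣_; _∣?_)
open import Data.Nat.Primality using (Prime; prime?)
open import Data.Integer as ℤ using (ℤ; +_; -[1+_])
open import Data.List using (List; []; _∷_; map; filter; length; replicate; _++_; foldr; upTo)
open import Data.Bool using (Bool; true; false; if_then_else_)
open import Data.Nat using (_%_; _≟_)
import Data.Bool as 𝔹
open import Data.Product using (Σ; _×_)
open import Relation.Nullary.Decidable using (_×-dec_; Dec; yes; no; does)
open import Relation.Binary.PropositionalEquality using (_≡_)

-- Integer polynomials as coefficient lists (constant term first)

Poly : Set
Poly = List ℤ

infixl 6 _+ₚ_
infixl 7 _*ₚ_

_+ₚ_ : Poly → Poly → Poly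
[]      +ₚ q       = q
(a ∷ p) +ₚ []      = a ∷ p
(a ∷ p) +ₚ (b ∷ q) = (a ℤ.+ b) ∷ (p +ₚ q)

_*ₚ_ : Poly → Poly → Poly
[]      *ₚ q = []
(a ∷ p) *ₚ q = map (a ℤ.*_) q +ₚ ((+ 0) ∷ (p *ₚ q))

coeff : Poly → ℕ → ℤ
coeff []      _       = + 0
coeff (a ∷ p) zero    = a
coeff (a ∷ p) (suc i) = coeff p i

_∣ₚ_ : Poly → Poly → Set
a ∣ₚ b = Σ Poly (λ q → ∀ i → coeff (a *ₚ q) i ≡ coeff b i)

xPowMinus1 : ℕ → Poly
xPowMinus1 c = (replicate c (+ 0) ++ (+ 1 ∷ [])) +ₚ (-[1+ 0 ] ∷ [])

-- F_C = ∏_{c ∈ C} (x^c - 1), F_∅ = 1   (C a finite set given as a duplicate-free list)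
F : List ℕ → Poly
F C = foldr (λ c acc → xPowMinus1 c *ₚ acc) (+ 1 ∷ []) C

ω : ℕ → ℕ
ω m = length (filter (λ p → prime? p ×-dec p ∣? m) (upTo (suc m)))

-- μ(m) = +1 iff ω(m) even (only used for square-free m, where μ(m) = (-1)^ω(m))
μ-is-plus : ℕ → Bool
μ-is-plus m = does ((ω m % 2) ≟ 0)

-- n / d (d ≠ 0 in all uses, since d ∣ n with n ≥ 1)
quot : ℕ → ℕ → ℕ
quot n zero    = zero
quot n (suc d) = n / suc d

data Sign : Set where
  plus minus : Sign

opp : Sign → Sign
opp plus  = minus
opp minus = plus

hasSign : ℕ → Sign → ℕ → Bool
hasSign n plus  d = μ-is-plus (quot n d)
hasSign n minus d = if μ-is-plus (quot n d) then false else true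

Bsgn : ℕ → Sign → List ℕ → List ℕ
Bsgn n s B = filter (λ d → hasSign n s d 𝔹.≟ true) B

countMult : ℕ → Sign → List ℕ → ℕ → ℕ
countMult n s B d = length (filter (λ b → d ∣? b) (Bsgn n s B))

module Submission where

-- We construct, by induction on the number of primes, polynomials Φ_d (d ∣ n) with
--     x^c - 1 = ∏_{d ∣ c} Φ_d      for every c ∣ n                                  (★)
-- (the cyclotomic polynomials). Passing from n to q·n for a new prime q we keep Φ_d and set
-- Φ_{qd} = Φ_d(x^q)/Φ_d; for this to be a polynomial the induction also carries the fact that
-- Φ_d divides Φ_d(x^p) for every prime p ∤ n. That fact is re-established for Φ_{qd} by comparing
-- the two expansions of Φ_d(x^(pq)) and using that Φ_d(x^q)/Φ_d and Φ_d(x^p)/Φ_d divide the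
-- comaximal polynomials G_q(x^d) and G_p(x^d), where G_k = 1 + x + ⋯ + x^(k-1).
-- By (★), F_C = ∏_{d ∣ n} Φ_d^{#{c ∈ C : d ∣ c}}, so F_C ∣ F_C′ as soon as every d divides no
-- more elements of C than of C′; for C = B^∓, C′ = B^± this is exactly C^±(B).

open import Defs
open import Data.Nat as ℕ using (ℕ; zero; suc; _<_; _≤_; _≥_; z≤n; nonTrivial⇒≢1; ≢-nonZero⁻¹)
import Data.Nat.Properties as ℕP
open import Data.Nat.Divisibility using (_∣_; _∣?_; divides; ∣-refl; ∣-trans; ∣1⇒≡1; 0∣⇒≡0; m∣m*n; ∣n⇒∣m*n; ∣m⇒∣m*n; *-monoʳ-∣; *-cancelˡ-∣)
open import Data.Nat.DivMod using (_/_; m*n/n≡m)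
open import Data.Nat.Primality using (Prime; euclidsLemma; prime⇒irreducible; prime⇒nonTrivial; prime⇒nonZero)
open import Data.Nat.Coprimality using (Coprime; coprime-divisor; coprime-Bézout)
open import Data.Nat.GCD using (module Bézout)
open import Data.Nat.ListAction using (product)
open import Data.Integer as ℤ using (ℤ; +_; -[1+_])
import Data.Integer.Properties as ℤP
open import Data.Integer.Tactic.RingSolver using () renaming (solve-∀ to solve-∀-ℤ)
open import Data.List using (List; []; _∷_; map; replicate; _++_; filter; length)
open import Data.List.Membership.Propositional using (_∈_)
open import Data.List.Membership.Propositional.Properties using (∈-++⁺ˡ; ∈-++⁺ʳ; ∈-++⁻; ∈-map⁺; ∈-map⁻; ∈-filter⁻)
open import Data.List.Membership.DecPropositional ℕP._≟_ using (_∈?_)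
open import Data.List.Relation.Unary.Any using (here; there)
open import Data.List.Relation.Unary.All as All using (All; []; _∷_)
open import Data.List.Relation.Unary.Linked using (Linked; []; [-]; _∷_)
open import Data.List.Relation.Unary.Linked.Properties using (Linked⇒All)
open import Data.List.Relation.Unary.Unique.Propositional using (Unique)
open import Data.Bool using (if_then_else_)
import Data.Bool as 𝔹
open import Data.Maybe using (Maybe; just; nothing)
open import Data.Product using (Σ; ∃; _,_; proj₁; proj₂; _×_)
open import Data.Sum using (_⊎_; inj₁; inj₂; [_,_]′)
open import Data.Unit using (⊤; tt)
open import Data.Empty using (⊥-elim)
open import Function using (id; _∘_)
open import Relation.Nullary using (¬_; yes; no; does)
open import Relation.Binary.PropositionalEquality using (_≡_; _≢_; refl; sym; trans; cong; cong₂; subst)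
open import Algebra.Bundles using (CommutativeRing)
open import Tactic.RingSolver using (solve-∀)
open import Tactic.RingSolver.Core.AlmostCommutativeRing using (AlmostCommutativeRing; fromCommutativeRing)

-- Coefficient lists are identified when they have the same coefficients, i.e. up to
-- trailing zeros; this is the equality of ℤ[x] under which _+ₚ_ and _*ₚ_ form a ring.
infix 4 _≈_
record _≈_ (p q : Poly) : Set where
  constructor mk
  field at : ∀ i → coeff p i ≡ coeff q i
open _≈_

module PolynomialLaws where

  ≈-refl : ∀ {p} → p ≈ p
  ≈-refl = mk λ i → refl

  ≈-sym : ∀ {p q} → p ≈ q → q ≈ p
  ≈-sym e = mk λ i → sym (at e i)

  ≈-trans : ∀ {p q r} → p ≈ q → q ≈ r → p ≈ r
  ≈-trans e f = mk λ i → trans (at e i) (at f i)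

  scale : ℤ → Poly → Poly
  scale a = map (a ℤ.*_)

  negate : Poly → Poly
  negate = map (λ a → ℤ.- a)

  shifted : Poly → ℕ → ℤ
  shifted r zero    = + 0
  shifted r (suc i) = coeff r i

  coeff-+ : ∀ p q i → coeff (p +ₚ q) i ≡ coeff p i ℤ.+ coeff q i
  coeff-+ []      q       i       = sym (ℤP.+-identityˡ _)
  coeff-+ (a ∷ p) []      zero    = sym (ℤP.+-identityʳ _)
  coeff-+ (a ∷ p) []      (suc i) = sym (ℤP.+-identityʳ _)
  coeff-+ (a ∷ p) (b ∷ q) zero    = refl
  coeff-+ (a ∷ p) (b ∷ q) (suc i) = coeff-+ p q i

  coeff-scale : ∀ a p i → coeff (scale a p) i ≡ a ℤ.* coeff p i
  coeff-scale a []      i       = sym (ℤP.*-zeroʳ a)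
  coeff-scale a (b ∷ p) zero    = refl
  coeff-scale a (b ∷ p) (suc i) = coeff-scale a p i

  coeff-negate : ∀ p i → coeff (negate p) i ≡ ℤ.- coeff p i
  coeff-negate []      i       = refl
  coeff-negate (b ∷ p) zero    = refl
  coeff-negate (b ∷ p) (suc i) = coeff-negate p i

  coeff-shift : ∀ r i → coeff (+ 0 ∷ r) i ≡ shifted r i
  coeff-shift r zero    = refl
  coeff-shift r (suc i) = refl

  shifted-+ : ∀ p q i → shifted (p +ₚ q) i ≡ shifted p i ℤ.+ shifted q i
  shifted-+ p q zero    = refl
  shifted-+ p q (suc i) = coeff-+ p q i

  shifted-cong : ∀ {p q} → p ≈ q → ∀ i → shifted p i ≡ shifted q i
  shifted-cong e zero    = refl
  shifted-cong e (suc i) = at e i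

  coeff-* : ∀ a p q i → coeff ((a ∷ p) *ₚ q) i ≡ a ℤ.* coeff q i ℤ.+ shifted (p *ₚ q) i
  coeff-* a p q i = trans (coeff-+ (scale a q) (+ 0 ∷ p *ₚ q) i)
    (cong₂ ℤ._+_ (coeff-scale a q i) (coeff-shift (p *ₚ q) i))

  +-cong : ∀ {p p′ q q′} → p ≈ p′ → q ≈ q′ → p +ₚ q ≈ p′ +ₚ q′
  +-cong {p} {p′} {q} {q′} e f = mk λ i →
    trans (coeff-+ p q i) (trans (cong₂ ℤ._+_ (at e i) (at f i)) (sym (coeff-+ p′ q′ i)))

  scale-cong : ∀ a {p q} → p ≈ q → scale a p ≈ scale a q
  scale-cong a {p} {q} e = mk λ i →
    trans (coeff-scale a p i) (trans (cong (a ℤ.*_) (at e i)) (sym (coeff-scale a q i)))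

  negate-cong : ∀ {p q} → p ≈ q → negate p ≈ negate q
  negate-cong {p} {q} e = mk λ i →
    trans (coeff-negate p i) (trans (cong (λ a → ℤ.- a) (at e i)) (sym (coeff-negate q i)))

  shift-cong : ∀ {p q} → p ≈ q → (+ 0 ∷ p) ≈ (+ 0 ∷ q)
  shift-cong e = mk λ { zero → refl ; (suc i) → at e i }

  *-zeroʳ : ∀ p → p *ₚ [] ≈ []
  *-zeroʳ p = mk (go p)
    where
    go : ∀ p i → coeff (p *ₚ []) i ≡ coeff [] i
    go []      i       = refl
    go (a ∷ p) zero    = refl
    go (a ∷ p) (suc i) = go p i

  *-consʳ : ∀ p b q → p *ₚ (b ∷ q) ≈ scale b p +ₚ (+ 0 ∷ p *ₚ q)
  *-consʳ p b q = mk (go p)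
    where
    exchange : ∀ a x b y z → a ℤ.* x ℤ.+ (b ℤ.* y ℤ.+ z) ≡ b ℤ.* y ℤ.+ (a ℤ.* x ℤ.+ z)
    exchange = solve-∀-ℤ
    go : ∀ p i → coeff (p *ₚ (b ∷ q)) i ≡ coeff (scale b p +ₚ (+ 0 ∷ p *ₚ q)) i
    go []      zero    = refl
    go []      (suc i) = refl
    go (a ∷ p) zero    = cong (ℤ._+ + 0) (ℤP.*-comm a b)
    go (a ∷ p) (suc j) =
      trans (coeff-+ (scale a q) (p *ₚ (b ∷ q)) j)
      (trans (cong₂ ℤ._+_ (coeff-scale a q j)
                (trans (go p j) (trans (coeff-+ (scale b p) _ j)
                  (cong₂ ℤ._+_ (coeff-scale b p j) (coeff-shift (p *ₚ q) j)))))
      (trans (exchange a (coeff q j) b (coeff p j) (shifted (p *ₚ q) j))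
      (sym (trans (coeff-+ (scale b p) ((a ∷ p) *ₚ q) j)
                  (cong₂ ℤ._+_ (coeff-scale b p j) (coeff-* a p q j))))))

  *-comm : ∀ p q → p *ₚ q ≈ q *ₚ p
  *-comm []      q = ≈-sym (*-zeroʳ q)
  *-comm (a ∷ p) q = ≈-trans (+-cong (≈-refl {scale a q}) (shift-cong (*-comm p q))) (≈-sym (*-consʳ q a p))

  *-congʳ : ∀ p {q q′} → q ≈ q′ → p *ₚ q ≈ p *ₚ q′
  *-congʳ []      e = ≈-refl
  *-congʳ (a ∷ p) e = +-cong (scale-cong a e) (shift-cong (*-congʳ p e))

  *-cong : ∀ {p p′ q q′} → p ≈ p′ → q ≈ q′ → p *ₚ q ≈ p′ *ₚ q′
  *-cong {p} {p′} {q} {q′} e f =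
    ≈-trans (*-comm p q) (≈-trans (*-congʳ q e) (≈-trans (*-comm q p′) (*-congʳ p′ f)))

  *-distribˡ : ∀ p q r → p *ₚ (q +ₚ r) ≈ p *ₚ q +ₚ p *ₚ r
  *-distribˡ []      q r = ≈-refl
  *-distribˡ (a ∷ p) q r = mk λ i →
    trans (coeff-* a p (q +ₚ r) i)
    (trans (cong₂ ℤ._+_ (trans (cong (a ℤ.*_) (coeff-+ q r i)) (ℤP.*-distribˡ-+ a (coeff q i) (coeff r i)))
                        (trans (shifted-cong (*-distribˡ p q r) i) (shifted-+ (p *ₚ q) (p *ₚ r) i)))
    (trans (regroup (a ℤ.* coeff q i) (a ℤ.* coeff r i) (shifted (p *ₚ q) i) (shifted (p *ₚ r) i))
    (sym (trans (coeff-+ ((a ∷ p) *ₚ q) ((a ∷ p) *ₚ r) i) (cong₂ ℤ._+_ (coeff-* a p q i) (coeff-* a p r i))))))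
    where
    regroup : ∀ x y z w → x ℤ.+ y ℤ.+ (z ℤ.+ w) ≡ x ℤ.+ z ℤ.+ (y ℤ.+ w)
    regroup = solve-∀-ℤ

  *-distribʳ : ∀ p q r → (q +ₚ r) *ₚ p ≈ q *ₚ p +ₚ r *ₚ p
  *-distribʳ p q r =
    ≈-trans (*-comm (q +ₚ r) p) (≈-trans (*-distribˡ p q r) (+-cong (*-comm p q) (*-comm p r)))

  scale-* : ∀ a q r → scale a q *ₚ r ≈ scale a (q *ₚ r)
  scale-* a []      r = mk λ i → sym (trans (coeff-scale a [] i) (ℤP.*-zeroʳ a))
  scale-* a (b ∷ q) r = mk λ i →
    trans (coeff-* (a ℤ.* b) (scale a q) r i)
    (trans (cong (λ t → a ℤ.* b ℤ.* coeff r i ℤ.+ t) (trans (shifted-cong (scale-* a q r) i) (shifted-scale (q *ₚ r) i)))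
    (trans (factor a b (coeff r i) (shifted (q *ₚ r) i))
    (sym (trans (coeff-scale a ((b ∷ q) *ₚ r) i) (cong (a ℤ.*_) (coeff-* b q r i))))))
    where
    factor : ∀ a b x y → a ℤ.* b ℤ.* x ℤ.+ a ℤ.* y ≡ a ℤ.* (b ℤ.* x ℤ.+ y)
    factor = solve-∀-ℤ
    shifted-scale : ∀ p i → shifted (scale a p) i ≡ a ℤ.* shifted p i
    shifted-scale p zero    = sym (ℤP.*-zeroʳ a)
    shifted-scale p (suc i) = coeff-scale a p i

  shift-* : ∀ p q → (+ 0 ∷ p) *ₚ q ≈ (+ 0 ∷ (p *ₚ q))
  shift-* p q = mk λ i →
    trans (coeff-* (+ 0) p q i)
    (trans (cong (ℤ._+ shifted (p *ₚ q) i) (ℤP.*-zeroˡ (coeff q i)))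
    (trans (ℤP.+-identityˡ _) (sym (coeff-shift _ i))))

  *-assoc : ∀ p q r → (p *ₚ q) *ₚ r ≈ p *ₚ (q *ₚ r)
  *-assoc []      q r = ≈-refl
  *-assoc (a ∷ p) q r = ≈-trans (*-distribʳ r (scale a q) (+ 0 ∷ p *ₚ q))
    (+-cong (scale-* a q r) (≈-trans (shift-* (p *ₚ q) r) (shift-cong (*-assoc p q r))))

  *-identityˡ : ∀ p → (+ 1 ∷ []) *ₚ p ≈ p
  *-identityˡ p = mk λ i →
    trans (coeff-* (+ 1) [] p i) (trans (cong₂ ℤ._+_ (ℤP.*-identityˡ (coeff p i)) (shifted-[] i)) (ℤP.+-identityʳ _))
    where
    shifted-[] : ∀ i → shifted [] i ≡ + 0
    shifted-[] zero    = refl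
    shifted-[] (suc i) = refl

  *-identityʳ : ∀ p → p *ₚ (+ 1 ∷ []) ≈ p
  *-identityʳ p = ≈-trans (*-comm p _) (*-identityˡ p)

  +-assoc : ∀ p q r → (p +ₚ q) +ₚ r ≈ p +ₚ (q +ₚ r)
  +-assoc p q r = mk λ i →
    trans (coeff-+ (p +ₚ q) r i) (trans (cong (ℤ._+ coeff r i) (coeff-+ p q i))
    (trans (ℤP.+-assoc (coeff p i) (coeff q i) (coeff r i))
    (sym (trans (coeff-+ p (q +ₚ r) i) (cong (λ t → coeff p i ℤ.+ t) (coeff-+ q r i))))))

  +-comm : ∀ p q → p +ₚ q ≈ q +ₚ p
  +-comm p q = mk λ i → trans (coeff-+ p q i) (trans (ℤP.+-comm (coeff p i) (coeff q i)) (sym (coeff-+ q p i)))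

  +-identityʳ : ∀ p → p +ₚ [] ≈ p
  +-identityʳ p = +-comm p []

  -‿inverseˡ : ∀ p → negate p +ₚ p ≈ []
  -‿inverseˡ p = mk λ i →
    trans (coeff-+ (negate p) p i) (trans (cong (ℤ._+ coeff p i) (coeff-negate p i)) (ℤP.+-inverseˡ (coeff p i)))

  -‿inverseʳ : ∀ p → p +ₚ negate p ≈ []
  -‿inverseʳ p = ≈-trans (+-comm p (negate p)) (-‿inverseˡ p)

open PolynomialLaws using (scale; negate; coeff-+; coeff-scale; coeff-*; shift-cong; *-consʳ; shift-*)

ℤ[x] : CommutativeRing _ _
ℤ[x] = record
  { Carrier = Poly ; _≈_ = _≈_ ; _+_ = _+ₚ_ ; _*_ = _*ₚ_ ; -_ = negate ; 0# = [] ; 1# = + 1 ∷ []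
  ; isCommutativeRing = record
    { isRing = record
      { +-isAbelianGroup = record
        { isGroup = record
          { isMonoid = record
            { isSemigroup = record
              { isMagma = record { isEquivalence = record { refl = ≈-refl ; sym = ≈-sym ; trans = ≈-trans }
                                 ; ∙-cong = +-cong }
              ; assoc = +-assoc }
            ; identity = (λ p → ≈-refl) , +-identityʳ }
          ; inverse = -‿inverseˡ , -‿inverseʳ
          ; ⁻¹-cong = negate-cong }
        ; comm = +-comm }
      ; *-cong = *-cong
      ; *-assoc = *-assoc
      ; *-identity = *-identityˡ , *-identityʳ
      ; distrib = *-distribˡ , *-distribʳ }
    ; *-comm = *-comm } }
  where open PolynomialLaws

-- ℤ[x] packaged for the ring solver. The solver needs to recognise zero constants, e.g. to see
-- that the coefficient 1 - 1 of a normal form vanishes.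
ℤ[x]-solverRing : AlmostCommutativeRing _ _
ℤ[x]-solverRing = fromCommutativeRing ℤ[x] isZero?
  where
  isZero? : ∀ p → Maybe ([] ≈ p)
  isZero? []           = just PolynomialLaws.≈-refl
  isZero? (+ zero ∷ p) with isZero? p
  ... | just e  = just (mk λ { zero → refl ; (suc i) → at e i })
  ... | nothing = nothing
  isZero? (_ ∷ p)      = nothing

open CommutativeRing ℤ[x]
  using (setoid; +-cong; +-comm; +-identityʳ; -‿cong; -‿inverseʳ; *-cong; *-comm; *-assoc; *-identityˡ; *-identityʳ; zeroʳ;
         commutativeSemiring; semiring; *-commutativeSemigroup)
  renaming (refl to ≈-refl; sym to ≈-sym; trans to ≈-trans; 1# to 1ₚ)
open import Relation.Binary.Reasoning.Setoid setoid
open import Algebra.Properties.CommutativeSemiring.Exp commutativeSemiring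
  using (_^_; ^-congˡ; ^-congʳ; ^-homo-*; ^-assocʳ; ^-distrib-*)
-- divisibility in ℤ[x]: a ∣ₓ b means q · a ≈ b for some q
open import Algebra.Properties.Semiring.Divisibility semiring
  using (∣ʳ-refl; ∣ʳ-trans; ∣ʳ-respʳ-≈; ∣ʳ-respˡ-≈; x∣ʳyx; _,_) renaming (_∣_ to _∣ₓ_)
open import Algebra.Properties.CommutativeSemigroup.Divisibility *-commutativeSemigroup
  using (∙-cong-∣; x∣xy)

∣ₓ⇒∣ₚ : ∀ {a b} → a ∣ₓ b → a ∣ₚ b
∣ₓ⇒∣ₚ {a} (q , qa≈b) = q , at (≈-trans (*-comm a q) qa≈b)

≡⇒≈ : ∀ {p q} → p ≡ q → p ≈ q
≡⇒≈ refl = ≈-refl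

-- congruence of multiplication in one factor; the fixed factor is explicit for inference
*-congˡ : ∀ p {q r} → q ≈ r → p *ₚ q ≈ p *ₚ r
*-congˡ p = *-cong (≈-refl {p})

*-congʳ : ∀ p {q r} → q ≈ r → q *ₚ p ≈ r *ₚ p
*-congʳ p e = *-cong e (≈-refl {p})

+-congˡ : ∀ p {q r} → q ≈ r → p +ₚ q ≈ p +ₚ r
+-congˡ p = +-cong (≈-refl {p})

infixl 6 _-ₚ_
_-ₚ_ : Poly → Poly → Poly
p -ₚ q = p +ₚ negate q

k[_] : ℤ → Poly
k[ a ] = a ∷ []

x : Poly
x = + 0 ∷ + 1 ∷ []

shift≈x* : ∀ p → (+ 0 ∷ p) ≈ x *ₚ p
shift≈x* p = ≈-trans (shift-cong (≈-sym (*-identityˡ p))) (≈-sym (shift-* 1ₚ p))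

xPowMinus1≈ : ∀ k → xPowMinus1 k ≈ x ^ k -ₚ 1ₚ
xPowMinus1≈ k = +-cong (monomial k) ≈-refl
  where
  monomial : ∀ k → replicate k (+ 0) ++ (+ 1 ∷ []) ≈ x ^ k
  monomial zero    = ≈-refl
  monomial (suc k) = ≈-trans (shift-cong (monomial k)) (shift≈x* (x ^ k))

X : ℕ → Poly
X = xPowMinus1

G : ℕ → Poly
G k = replicate k (+ 1)

X≈X1*G : ∀ k → X k ≈ X 1 *ₚ G k
X≈X1*G zero    = ≈-trans (mk λ { zero → refl ; (suc i) → refl }) (≈-sym (zeroʳ (X 1)))
X≈X1*G (suc k) = begin
  X (suc k)                         ≈⟨ xPowMinus1≈ (suc k) ⟩
  x *ₚ x ^ k -ₚ 1ₚ                  ≈⟨ telescope x (x ^ k) ⟩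
  (x -ₚ 1ₚ) +ₚ x *ₚ (x ^ k -ₚ 1ₚ)   ≈⟨ +-cong (≈-sym (xPowMinus1≈ 1)) (*-congˡ x (≈-sym (xPowMinus1≈ k))) ⟩
  X 1 +ₚ x *ₚ X k                   ≈⟨ +-congˡ (X 1) (*-congˡ x (X≈X1*G k)) ⟩
  X 1 +ₚ x *ₚ (X 1 *ₚ G k)          ≈⟨ factor (X 1) x (G k) ⟩
  X 1 *ₚ (1ₚ +ₚ x *ₚ G k)           ≈⟨ *-congˡ (X 1) (≈-sym G-suc) ⟩
  X 1 *ₚ G (suc k)                  ∎
  where
  telescope : ∀ a b → a *ₚ b -ₚ 1ₚ ≈ (a -ₚ 1ₚ) +ₚ a *ₚ (b -ₚ 1ₚ)
  telescope = solve-∀ ℤ[x]-solverRing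
  factor : ∀ a b c → a +ₚ b *ₚ (a *ₚ c) ≈ a *ₚ (1ₚ +ₚ b *ₚ c)
  factor = solve-∀ ℤ[x]-solverRing
  G-suc : G (suc k) ≈ 1ₚ +ₚ x *ₚ G k
  G-suc = ≈-trans (mk λ { zero → refl ; (suc i) → refl }) (+-congˡ 1ₚ (shift≈x* (G k)))

infixl 9 _[x^_]
_[x^_] : Poly → ℕ → Poly
[]      [x^ k ] = []
(a ∷ p) [x^ k ] = k[ a ] +ₚ x ^ k *ₚ p [x^ k ]

module _ (k : ℕ) where

  private
    k[0]≈0 : k[ + 0 ] ≈ []
    k[0]≈0 = mk λ { zero → refl ; (suc i) → refl }

  subst-zero : ∀ p → p ≈ [] → p [x^ k ] ≈ []
  subst-zero []      e = ≈-refl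
  subst-zero (a ∷ p) e = ≈-trans (+-cong (mk λ { zero → at e 0 ; (suc i) → refl })
                                         (*-congˡ (x ^ k) (subst-zero p (mk λ i → at e (suc i)))))
                                 (zeroʳ (x ^ k))

  subst-cong : ∀ {p q} → p ≈ q → p [x^ k ] ≈ q [x^ k ]
  subst-cong {[]}    {q}     e = ≈-sym (subst-zero q (≈-sym e))
  subst-cong {a ∷ p} {[]}    e = subst-zero (a ∷ p) e
  subst-cong {a ∷ p} {b ∷ q} e rewrite at e 0 =
    +-congˡ k[ b ] (*-congˡ (x ^ k) (subst-cong {p} {q} (mk λ i → at e (suc i))))

  subst-+ : ∀ p q → (p +ₚ q) [x^ k ] ≈ p [x^ k ] +ₚ q [x^ k ]
  subst-+ []      q       = ≈-refl
  subst-+ (a ∷ p) []      = ≈-sym (+-identityʳ _)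
  subst-+ (a ∷ p) (b ∷ q) = begin
    k[ a ℤ.+ b ] +ₚ x ^ k *ₚ (p +ₚ q) [x^ k ]
      ≈⟨ +-cong (mk λ { zero → refl ; (suc i) → refl }) (*-congˡ (x ^ k) (subst-+ p q)) ⟩
    (k[ a ] +ₚ k[ b ]) +ₚ x ^ k *ₚ (p [x^ k ] +ₚ q [x^ k ])
      ≈⟨ regroup k[ a ] k[ b ] (x ^ k) (p [x^ k ]) (q [x^ k ]) ⟩
    (k[ a ] +ₚ x ^ k *ₚ p [x^ k ]) +ₚ (k[ b ] +ₚ x ^ k *ₚ q [x^ k ]) ∎
    where
    regroup : ∀ a b y s t → (a +ₚ b) +ₚ y *ₚ (s +ₚ t) ≈ (a +ₚ y *ₚ s) +ₚ (b +ₚ y *ₚ t)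
    regroup = solve-∀ ℤ[x]-solverRing

  subst-const : ∀ a → k[ a ] [x^ k ] ≈ k[ a ]
  subst-const a = ≈-trans (+-congˡ k[ a ] (zeroʳ (x ^ k))) (+-identityʳ _)

  subst-* : ∀ p q → (p *ₚ q) [x^ k ] ≈ p [x^ k ] *ₚ q [x^ k ]
  subst-* []      q = ≈-refl
  subst-* (a ∷ p) q = begin
    (scale a q +ₚ (+ 0 ∷ p *ₚ q)) [x^ k ]
      ≈⟨ subst-+ (scale a q) _ ⟩
    scale a q [x^ k ] +ₚ (k[ + 0 ] +ₚ x ^ k *ₚ (p *ₚ q) [x^ k ])
      ≈⟨ +-cong (subst-scale a q) (+-cong k[0]≈0 (*-congˡ (x ^ k) (subst-* p q))) ⟩
    k[ a ] *ₚ q [x^ k ] +ₚ ([] +ₚ x ^ k *ₚ (p [x^ k ] *ₚ q [x^ k ]))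
      ≈⟨ distribute k[ a ] (x ^ k) (p [x^ k ]) (q [x^ k ]) ⟩
    (k[ a ] +ₚ x ^ k *ₚ p [x^ k ]) *ₚ q [x^ k ] ∎
    where
    distribute : ∀ a y s t → a *ₚ t +ₚ ([] +ₚ y *ₚ (s *ₚ t)) ≈ (a +ₚ y *ₚ s) *ₚ t
    distribute = solve-∀ ℤ[x]-solverRing
    subst-scale : ∀ a p → (scale a p) [x^ k ] ≈ k[ a ] *ₚ p [x^ k ]
    subst-scale a []      = ≈-sym (zeroʳ k[ a ])
    subst-scale a (b ∷ p) = begin
      k[ a ℤ.* b ] +ₚ x ^ k *ₚ (scale a p) [x^ k ]
        ≈⟨ +-cong (mk λ { zero → sym (ℤP.+-identityʳ _) ; (suc i) → refl }) (*-congˡ (x ^ k) (subst-scale a p)) ⟩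
      k[ a ] *ₚ k[ b ] +ₚ x ^ k *ₚ (k[ a ] *ₚ p [x^ k ])
        ≈⟨ factor k[ a ] k[ b ] (x ^ k) (p [x^ k ]) ⟩
      k[ a ] *ₚ (k[ b ] +ₚ x ^ k *ₚ p [x^ k ]) ∎
      where
      factor : ∀ a b y s → a *ₚ b +ₚ y *ₚ (a *ₚ s) ≈ a *ₚ (b +ₚ y *ₚ s)
      factor = solve-∀ ℤ[x]-solverRing

  subst-^ : ∀ p m → (p ^ m) [x^ k ] ≈ p [x^ k ] ^ m
  subst-^ p zero    = subst-const (+ 1)
  subst-^ p (suc m) = ≈-trans (subst-* p (p ^ m)) (*-congˡ (p [x^ k ]) (subst-^ p m))

  subst-x^ : ∀ m → (x ^ m) [x^ k ] ≈ x ^ (k ℕ.* m)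
  subst-x^ m = begin
    (x ^ m) [x^ k ]   ≈⟨ subst-^ x m ⟩
    x [x^ k ] ^ m     ≈⟨ ^-congˡ m (≈-trans (+-cong k[0]≈0 (*-congˡ (x ^ k) (subst-const (+ 1)))) (*-identityʳ (x ^ k))) ⟩
    (x ^ k) ^ m       ≈⟨ ^-assocʳ x k m ⟩
    x ^ (k ℕ.* m)     ∎

  subst-X : ∀ m → X m [x^ k ] ≈ X (k ℕ.* m)
  subst-X m = begin
    X m [x^ k ]                          ≈⟨ subst-cong (xPowMinus1≈ m) ⟩
    (x ^ m -ₚ 1ₚ) [x^ k ]                ≈⟨ subst-+ (x ^ m) k[ -[1+ 0 ] ] ⟩
    (x ^ m) [x^ k ] +ₚ k[ -[1+ 0 ] ] [x^ k ] ≈⟨ +-cong (subst-x^ m) (subst-const -[1+ 0 ]) ⟩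
    x ^ (k ℕ.* m) -ₚ 1ₚ                  ≈⟨ ≈-sym (xPowMinus1≈ (k ℕ.* m)) ⟩
    X (k ℕ.* m)                          ∎

-- Substitutions x ↦ x^a and x ↦ x^b commute: both give p(x^(ab)).
subst-subst : ∀ a b p → p [x^ a ] [x^ b ] ≈ p [x^ b ] [x^ a ]
subst-subst a b p = ≈-trans (compose a b p) (≈-trans (≡⇒≈ (cong (p [x^_]) (ℕP.*-comm a b))) (≈-sym (compose b a p)))
  where
  compose : ∀ a b p → p [x^ a ] [x^ b ] ≈ p [x^ a ℕ.* b ]
  compose a b []      = ≈-refl
  compose a b (c ∷ p) = begin
    (k[ c ] +ₚ x ^ a *ₚ p [x^ a ]) [x^ b ]           ≈⟨ subst-+ b k[ c ] (x ^ a *ₚ p [x^ a ]) ⟩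
    k[ c ] [x^ b ] +ₚ (x ^ a *ₚ p [x^ a ]) [x^ b ]   ≈⟨ +-cong (subst-const b c) (subst-* b (x ^ a) (p [x^ a ])) ⟩
    k[ c ] +ₚ (x ^ a) [x^ b ] *ₚ p [x^ a ] [x^ b ]   ≈⟨ +-congˡ k[ c ] (*-cong (subst-x^ b a) (compose a b p)) ⟩
    k[ c ] +ₚ x ^ (b ℕ.* a) *ₚ p [x^ a ℕ.* b ]       ≈⟨ +-congˡ k[ c ] (*-congʳ (p [x^ a ℕ.* b ]) (≡⇒≈ (cong (x ^_) (ℕP.*-comm b a)))) ⟩
    k[ c ] +ₚ x ^ (a ℕ.* b) *ₚ p [x^ a ℕ.* b ]       ∎

X-factor : ∀ a b → X (a ℕ.* b) ≈ X a *ₚ G b [x^ a ]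
X-factor a b = begin
  X (a ℕ.* b)                    ≈⟨ ≈-sym (subst-X a b) ⟩
  X b [x^ a ]                    ≈⟨ subst-cong a (X≈X1*G b) ⟩
  (X 1 *ₚ G b) [x^ a ]           ≈⟨ subst-* a (X 1) (G b) ⟩
  X 1 [x^ a ] *ₚ G b [x^ a ]     ≈⟨ *-congʳ (G b [x^ a ]) (subst-X a 1) ⟩
  X (a ℕ.* 1) *ₚ G b [x^ a ]     ≈⟨ *-congʳ (G b [x^ a ]) (≡⇒≈ (cong X (ℕP.*-identityʳ a))) ⟩
  X a *ₚ G b [x^ a ]             ∎

NonzeroConstant : Poly → Set
NonzeroConstant g = coeff g 0 ≢ + 0

coeff₀-* : ∀ p q → coeff (p *ₚ q) 0 ≡ coeff p 0 ℤ.* coeff q 0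
coeff₀-* []      q = sym (ℤP.*-zeroˡ (coeff q 0))
coeff₀-* (a ∷ p) q = trans (coeff-* a p q 0) (ℤP.+-identityʳ _)

-- Polynomials with nonzero constant term are not zero divisors in ℤ[x]: by induction on h,
-- the constant term of h vanishes since ℤ is a domain, and then g·h is g·(h/x) shifted.
cancel-zero : ∀ g h → NonzeroConstant g → g *ₚ h ≈ [] → h ≈ []
cancel-zero g []      nz e = ≈-refl
cancel-zero g (b ∷ h) nz e = mk λ { zero → b≡0 ; (suc i) → at (cancel-zero g h nz tail≈0) i }
  where
  b≡0 : b ≡ + 0
  b≡0 = [ ⊥-elim ∘ nz , id ]′
          (ℤP.i*j≡0⇒i≡0∨j≡0 (coeff g 0) (trans (sym (coeff₀-* g (b ∷ h))) (at e 0)))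
  tail≈0 : g *ₚ h ≈ []
  tail≈0 = mk λ i → trans (sym (shifted-coeff i)) (at e (suc i))
    where
    shifted-coeff : ∀ i → coeff (g *ₚ (b ∷ h)) (suc i) ≡ coeff (g *ₚ h) i
    shifted-coeff i = trans (at (*-consʳ g b h) (suc i))
               (trans (coeff-+ (scale b g) (+ 0 ∷ g *ₚ h) (suc i))
               (trans (cong (ℤ._+ coeff (g *ₚ h) i) (trans (coeff-scale b g (suc i)) (trans (cong (ℤ._* coeff g (suc i)) b≡0) (ℤP.*-zeroˡ (coeff g (suc i))))))
                        (ℤP.+-identityˡ _)))

cancel : ∀ g a b → NonzeroConstant g → g *ₚ a ≈ g *ₚ b → a ≈ b
cancel g a b nz e = begin
  a                  ≈⟨ split a b ⟩
  (a -ₚ b) +ₚ b      ≈⟨ +-cong (cancel-zero g (a -ₚ b) nz g[a-b]≈0) ≈-refl ⟩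
  [] +ₚ b            ≈⟨ ≈-refl ⟩
  b                  ∎
  where
  split : ∀ a b → a ≈ (a -ₚ b) +ₚ b
  split = solve-∀ ℤ[x]-solverRing
  distribute : ∀ g a b → g *ₚ (a -ₚ b) ≈ g *ₚ a -ₚ g *ₚ b
  distribute = solve-∀ ℤ[x]-solverRing
  g[a-b]≈0 : g *ₚ (a -ₚ b) ≈ []
  g[a-b]≈0 = ≈-trans (distribute g a b) (≈-trans (+-cong e ≈-refl) (-‿inverseʳ (g *ₚ b)))

nonzeroConstant-divisor : ∀ {g c} → g ∣ₓ c → NonzeroConstant c → NonzeroConstant g
nonzeroConstant-divisor {g} {c} (h , e) nz g₀≡0 =
  nz (trans (sym (at e 0)) (trans (coeff₀-* h g) (trans (cong (coeff h 0 ℤ.*_) g₀≡0) (ℤP.*-zeroʳ (coeff h 0)))))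

X-nonzeroConstant : ∀ k → NonzeroConstant (X (suc k))
X-nonzeroConstant k ()

Comaximal : Poly → Poly → Set
Comaximal U V = Σ Poly λ u → Σ Poly λ v → u *ₚ U +ₚ v *ₚ V ≈ 1ₚ

comaximal-sym : ∀ {U V} → Comaximal U V → Comaximal V U
comaximal-sym {U} {V} (u , v , e) = v , u , ≈-trans (+-comm (v *ₚ V) (u *ₚ U)) e

comaximal-cancel : ∀ {U V W} → Comaximal U V → U ∣ₓ V *ₚ W → U ∣ₓ W
comaximal-cancel {U} {V} {W} (u , v , e) (q , qU≈VW) = u *ₚ W +ₚ v *ₚ q , (begin
  (u *ₚ W +ₚ v *ₚ q) *ₚ U       ≈⟨ expand u W v q U ⟩
  (u *ₚ U) *ₚ W +ₚ v *ₚ (q *ₚ U) ≈⟨ +-congˡ ((u *ₚ U) *ₚ W) (*-congˡ v qU≈VW) ⟩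
  (u *ₚ U) *ₚ W +ₚ v *ₚ (V *ₚ W) ≈⟨ collect (u *ₚ U) v V W ⟩
  (u *ₚ U +ₚ v *ₚ V) *ₚ W       ≈⟨ *-congʳ W e ⟩
  1ₚ *ₚ W                       ≈⟨ *-identityˡ W ⟩
  W                             ∎)
  where
  expand : ∀ u W v q U → (u *ₚ W +ₚ v *ₚ q) *ₚ U ≈ (u *ₚ U) *ₚ W +ₚ v *ₚ (q *ₚ U)
  expand = solve-∀ ℤ[x]-solverRing
  collect : ∀ a v V W → a *ₚ W +ₚ v *ₚ (V *ₚ W) ≈ (a +ₚ v *ₚ V) *ₚ W
  collect = solve-∀ ℤ[x]-solverRing

comaximal-divisors : ∀ {U V U′ V′} → Comaximal U V → U′ ∣ₓ U → V′ ∣ₓ V → Comaximal U′ V′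
comaximal-divisors {U} {V} {U′} {V′} (u , v , e) (a , aU′≈U) (b , bV′≈V) = u *ₚ a , v *ₚ b , (begin
  (u *ₚ a) *ₚ U′ +ₚ (v *ₚ b) *ₚ V′ ≈⟨ +-cong (*-assoc u a U′) (*-assoc v b V′) ⟩
  u *ₚ (a *ₚ U′) +ₚ v *ₚ (b *ₚ V′) ≈⟨ +-cong (*-congˡ u aU′≈U) (*-congˡ v bV′≈V) ⟩
  u *ₚ U +ₚ v *ₚ V                 ≈⟨ e ⟩
  1ₚ                               ∎)

comaximal-subst : ∀ k {U V} → Comaximal U V → Comaximal (U [x^ k ]) (V [x^ k ])
comaximal-subst k {U} {V} (u , v , e) = u [x^ k ] , v [x^ k ] , (begin
  u [x^ k ] *ₚ U [x^ k ] +ₚ v [x^ k ] *ₚ V [x^ k ] ≈⟨ ≈-sym (+-cong (subst-* k u U) (subst-* k v V)) ⟩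
  (u *ₚ U) [x^ k ] +ₚ (v *ₚ V) [x^ k ]             ≈⟨ ≈-sym (subst-+ k (u *ₚ U) (v *ₚ V)) ⟩
  (u *ₚ U +ₚ v *ₚ V) [x^ k ]                       ≈⟨ subst-cong k e ⟩
  1ₚ [x^ k ]                                       ≈⟨ subst-const k (+ 1) ⟩
  1ₚ                                               ∎)

-- If s·p = 1 + t·q then G_s(x^p)·G p - x·G_t(x^q)·G q = 1, as seen after multiplying by x - 1.
comaximal-from-Bézout : ∀ p q s t → 1 ℕ.+ t ℕ.* q ≡ s ℕ.* p → Comaximal (G p) (G q)
comaximal-from-Bézout p q s t eq = A , B , cancel (X 1) (A *ₚ G p +ₚ B *ₚ G q) 1ₚ (X-nonzeroConstant 0) (begin
  X 1 *ₚ (A *ₚ G p +ₚ B *ₚ G q)                           ≈⟨ regroup (X 1) (G p) (G q) (G s [x^ p ]) (G t [x^ q ]) x ⟩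
  (X 1 *ₚ G p) *ₚ G s [x^ p ] -ₚ x *ₚ ((X 1 *ₚ G q) *ₚ G t [x^ q ])
    ≈⟨ +-cong (*-congʳ (G s [x^ p ]) (≈-sym (X≈X1*G p))) (-‿cong (*-congˡ x (*-congʳ (G t [x^ q ]) (≈-sym (X≈X1*G q))))) ⟩
  X p *ₚ G s [x^ p ] -ₚ x *ₚ (X q *ₚ G t [x^ q ])         ≈⟨ +-cong (≈-sym (X-factor p s)) (-‿cong (*-congˡ x (≈-sym (X-factor q t)))) ⟩
  X (p ℕ.* s) -ₚ x *ₚ X (q ℕ.* t)                         ≈⟨ +-cong (≡⇒≈ (cong X ps≡1+qt)) ≈-refl ⟩
  X (suc (q ℕ.* t)) -ₚ x *ₚ X (q ℕ.* t)                   ≈⟨ +-cong (xPowMinus1≈ (suc (q ℕ.* t))) (-‿cong (*-congˡ x (xPowMinus1≈ (q ℕ.* t)))) ⟩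
  (x *ₚ x ^ (q ℕ.* t) -ₚ 1ₚ) -ₚ x *ₚ (x ^ (q ℕ.* t) -ₚ 1ₚ) ≈⟨ telescope x (x ^ (q ℕ.* t)) ⟩
  x -ₚ 1ₚ                                                 ≈⟨ ≈-sym (≈-trans (*-identityʳ (X 1)) (xPowMinus1≈ 1)) ⟩
  X 1 *ₚ 1ₚ                                               ∎)
  where
  A = G s [x^ p ]
  B = negate (x *ₚ G t [x^ q ])
  ps≡1+qt : p ℕ.* s ≡ suc (q ℕ.* t)
  ps≡1+qt = trans (ℕP.*-comm p s) (trans (sym eq) (cong suc (ℕP.*-comm t q)))
  regroup : ∀ X₁ gp gq a b y → X₁ *ₚ (a *ₚ gp +ₚ negate (y *ₚ b) *ₚ gq) ≈ (X₁ *ₚ gp) *ₚ a -ₚ y *ₚ ((X₁ *ₚ gq) *ₚ b)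
  regroup = solve-∀ ℤ[x]-solverRing
  telescope : ∀ a b → (a *ₚ b -ₚ 1ₚ) -ₚ a *ₚ (b -ₚ 1ₚ) ≈ a -ₚ 1ₚ
  telescope = solve-∀ ℤ[x]-solverRing

geometric-comaximal : ∀ p q → Coprime p q → Comaximal (G p) (G q)
geometric-comaximal p q c with coprime-Bézout c
... | Bézout.+- s t eq = comaximal-from-Bézout p q s t eq
... | Bézout.-+ s t eq = comaximal-sym (comaximal-from-Bézout q p t s eq)

-- Suppose A(x^q) = B_q·A and A(x^p) = B_p·A, where A has nonzero constant term and
-- B_q, B_p are comaximal. Then B_q divides B_q(x^p): expanding A(x^(pq)) in the two orders gives
-- B_q(x^p)·B_p·A = B_p(x^q)·B_q·A, so B_q divides B_p·B_q(x^p), and Euclid's lemma applies.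
quotient∣subst : ∀ {A Bq Bp} p q → NonzeroConstant A →
                 A [x^ q ] ≈ Bq *ₚ A → A [x^ p ] ≈ Bp *ₚ A → Comaximal Bq Bp → Bq ∣ₓ Bq [x^ p ]
quotient∣subst {A} {Bq} {Bp} p q nz A[q] A[p] comaximal =
  comaximal-cancel comaximal (Bp [x^ q ] , ≈-trans crossed (*-comm (Bq [x^ p ]) Bp))
  where
  crossed : Bp [x^ q ] *ₚ Bq ≈ Bq [x^ p ] *ₚ Bp
  crossed = cancel A _ _ nz (begin
    A *ₚ (Bp [x^ q ] *ₚ Bq)      ≈⟨ rotate A (Bp [x^ q ]) Bq ⟩
    Bp [x^ q ] *ₚ (Bq *ₚ A)      ≈⟨ *-congˡ (Bp [x^ q ]) (≈-sym A[q]) ⟩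
    Bp [x^ q ] *ₚ A [x^ q ]      ≈⟨ ≈-sym (subst-* q Bp A) ⟩
    (Bp *ₚ A) [x^ q ]            ≈⟨ subst-cong q (≈-sym A[p]) ⟩
    A [x^ p ] [x^ q ]            ≈⟨ subst-subst p q A ⟩
    A [x^ q ] [x^ p ]            ≈⟨ subst-cong p A[q] ⟩
    (Bq *ₚ A) [x^ p ]            ≈⟨ subst-* p Bq A ⟩
    Bq [x^ p ] *ₚ A [x^ p ]      ≈⟨ *-congˡ (Bq [x^ p ]) A[p] ⟩
    Bq [x^ p ] *ₚ (Bp *ₚ A)      ≈⟨ ≈-sym (rotate A (Bq [x^ p ]) Bp) ⟩
    A *ₚ (Bq [x^ p ] *ₚ Bp)      ∎)
    where
    rotate : ∀ a b c → a *ₚ (b *ₚ c) ≈ b *ₚ (c *ₚ a)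
    rotate a b c = ≈-trans (*-comm a (b *ₚ c)) (*-assoc b c a)

∏ : List ℕ → (ℕ → Poly) → Poly
∏ []      h = 1ₚ
∏ (f ∷ L) h = h f *ₚ ∏ L h

∏-cong : ∀ L {h h′} → (∀ {f} → f ∈ L → h f ≈ h′ f) → ∏ L h ≈ ∏ L h′
∏-cong []      e = ≈-refl
∏-cong (f ∷ L) e = *-cong (e (here refl)) (∏-cong L (λ f∈L → e (there f∈L)))

∏-++ : ∀ L M h → ∏ (L ++ M) h ≈ ∏ L h *ₚ ∏ M h
∏-++ []      M h = ≈-sym (*-identityˡ _)
∏-++ (f ∷ L) M h = ≈-trans (*-congˡ (h f) (∏-++ L M h)) (≈-sym (*-assoc (h f) _ _))

∏-map : ∀ L g h → ∏ (map g L) h ≈ ∏ L (λ f → h (g f))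
∏-map []      g h = ≈-refl
∏-map (f ∷ L) g h = *-congˡ (h (g f)) (∏-map L g h)

∏-* : ∀ L h h′ → ∏ L (λ f → h f *ₚ h′ f) ≈ ∏ L h *ₚ ∏ L h′
∏-* []      h h′ = ≈-sym (*-identityˡ 1ₚ)
∏-* (f ∷ L) h h′ = ≈-trans (*-congˡ (h f *ₚ h′ f) (∏-* L h h′)) (interchange (h f) (h′ f) (∏ L h) (∏ L h′))
  where
  interchange : ∀ a b c d → (a *ₚ b) *ₚ (c *ₚ d) ≈ (a *ₚ c) *ₚ (b *ₚ d)
  interchange = solve-∀ ℤ[x]-solverRing

∏-1 : ∀ L h → (∀ {f} → f ∈ L → h f ≈ 1ₚ) → ∏ L h ≈ 1ₚ
∏-1 L h e = ≈-trans (∏-cong L e) (all-ones L)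
  where
  all-ones : ∀ L → ∏ L (λ _ → 1ₚ) ≈ 1ₚ
  all-ones []      = ≈-refl
  all-ones (_ ∷ L) = ≈-trans (*-identityˡ _) (all-ones L)

∏-subst : ∀ k L h → (∏ L h) [x^ k ] ≈ ∏ L (λ f → h f [x^ k ])
∏-subst k []      h = subst-const k (+ 1)
∏-subst k (f ∷ L) h = ≈-trans (subst-* k (h f) (∏ L h)) (*-congˡ (h f [x^ k ]) (∏-subst k L h))

factor∣∏ : ∀ L h {f} → f ∈ L → h f ∣ₓ ∏ L h
factor∣∏ (g ∷ L) h (here refl) = x∣xy (h g) (∏ L h)
factor∣∏ (g ∷ L) h (there f∈L) = ∣ʳ-trans (factor∣∏ L h f∈L) (x∣ʳyx (∏ L h) (h g))

∏-∣ : ∀ L h h′ → (∀ {f} → f ∈ L → h f ∣ₓ h′ f) → ∏ L h ∣ₓ ∏ L h′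
∏-∣ []      h h′ d = ∣ʳ-refl
∏-∣ (f ∷ L) h h′ d = ∙-cong-∣ (d (here refl)) (∏-∣ L h h′ (λ f∈L → d (there f∈L)))

⟦_∣_⟧ : ℕ → ℕ → ℕ
⟦ f ∣ c ⟧ = if does (f ∣? c) then 1 else 0

⟦∣⟧-cong : ∀ {f c g d} → (f ∣ c → g ∣ d) → (g ∣ d → f ∣ c) → ⟦ f ∣ c ⟧ ≡ ⟦ g ∣ d ⟧
⟦∣⟧-cong {f} {c} {g} {d} to from with f ∣? c | g ∣? d
... | yes _   | yes _   = refl
... | no  _   | no  _   = refl
... | yes f∣c | no  g∤d = ⊥-elim (g∤d (to f∣c))
... | no  f∤c | yes g∣d = ⊥-elim (f∤c (from g∣d))

⟦∣⟧≡0 : ∀ {f c} → ¬ f ∣ c → ⟦ f ∣ c ⟧ ≡ 0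
⟦∣⟧≡0 {f} {c} f∤c with f ∣? c
... | yes f∣c = ⊥-elim (f∤c f∣c)
... | no  _   = refl

⟦∣⟧≡1 : ∀ {f c} → f ∣ c → ⟦ f ∣ c ⟧ ≡ 1
⟦∣⟧≡1 {f} {c} f∣c with f ∣? c
... | yes _   = refl
... | no  f∤c = ⊥-elim (f∤c f∣c)

mult : List ℕ → ℕ → ℕ
mult C f = length (filter (λ b → f ∣? b) C)

mult-∷ : ∀ c C f → mult (c ∷ C) f ≡ ⟦ f ∣ c ⟧ ℕ.+ mult C f
mult-∷ c C f with f ∣? c
... | yes _ = refl
... | no  _ = refl

divisorProduct : List ℕ → (ℕ → Poly) → ℕ → Poly
divisorProduct L Φ c = ∏ L (λ f → Φ f ^ ⟦ f ∣ c ⟧)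

factor∣divisorProduct : ∀ L Φ {f c} → f ∈ L → f ∣ c → Φ f ∣ₓ divisorProduct L Φ c
factor∣divisorProduct L Φ {f} {c} f∈L f∣c =
  ∣ʳ-trans (∣ʳ-respʳ-≈ (≈-sym (≈-trans (^-congʳ (Φ f) (⟦∣⟧≡1 f∣c)) (*-identityʳ (Φ f)))) ∣ʳ-refl)
           (factor∣∏ L (λ f → Φ f ^ ⟦ f ∣ c ⟧) f∈L)

divisorProduct-subst : ∀ L Φ Ψ p → (∀ {f} → f ∈ L → Φ f [x^ p ] ≈ Ψ f *ₚ Φ f) →
                       ∀ c → divisorProduct L Φ c [x^ p ] ≈ divisorProduct L Ψ c *ₚ divisorProduct L Φ c
divisorProduct-subst L Φ Ψ p split c = begin
  divisorProduct L Φ c [x^ p ]                       ≈⟨ ∏-subst p L (λ f → Φ f ^ ⟦ f ∣ c ⟧) ⟩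
  ∏ L (λ f → (Φ f ^ ⟦ f ∣ c ⟧) [x^ p ])              ≈⟨ ∏-cong L (λ {f} f∈L → ≈-trans (subst-^ p (Φ f) ⟦ f ∣ c ⟧)
                                                          (≈-trans (^-congˡ ⟦ f ∣ c ⟧ (split f∈L)) (^-distrib-* (Ψ f) (Φ f) ⟦ f ∣ c ⟧))) ⟩
  ∏ L (λ f → Ψ f ^ ⟦ f ∣ c ⟧ *ₚ Φ f ^ ⟦ f ∣ c ⟧)     ≈⟨ ∏-* L (λ f → Ψ f ^ ⟦ f ∣ c ⟧) (λ f → Φ f ^ ⟦ f ∣ c ⟧) ⟩
  divisorProduct L Ψ c *ₚ divisorProduct L Φ c       ∎

prime≢1 : ∀ {q} → Prime q → q ≢ 1
prime≢1 q-prime = nonTrivial⇒≢1 {{prime⇒nonTrivial q-prime}}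

DistinctPrimes : List ℕ → Set
DistinctPrimes []       = ⊤
DistinctPrimes (q ∷ ps) = Prime q × ¬ q ∣ product ps × DistinctPrimes ps

increasing⇒distinct : ∀ ps → Linked _<_ ps → All Prime ps → DistinctPrimes ps
increasing⇒distinct []       _      _                    = tt
increasing⇒distinct (q ∷ rs) linked (q-prime ∷ rs-prime) =
  q-prime , smaller∤product rs (below rs linked) rs-prime , increasing⇒distinct rs (tail linked) rs-prime
  where
  below : ∀ rs → Linked _<_ (q ∷ rs) → All (q <_) rs
  below []       _              = []
  below (r ∷ rs) (q<r ∷ linked) = Linked⇒All ℕP.<-trans q<r linked
  tail : ∀ {rs} → Linked _<_ (q ∷ rs) → Linked _<_ rs
  tail [-]          = []
  tail (_ ∷ linked) = linked
  -- a prime factor of ∏ rs equals one of the rs, so it cannot be smaller than all of them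
  smaller∤product : ∀ rs → All (q <_) rs → All Prime rs → ¬ q ∣ product rs
  smaller∤product []       []           []                   q∣1 = prime≢1 q-prime (∣1⇒≡1 q∣1)
  smaller∤product (r ∷ rs) (q<r ∷ q<rs) (r-prime ∷ rs-prime) q∣rrs with euclidsLemma r (product rs) q-prime q∣rrs
  ... | inj₂ q∣rs = smaller∤product rs q<rs rs-prime q∣rs
  ... | inj₁ q∣r with prime⇒irreducible r-prime q∣r
  ...   | inj₁ refl = prime≢1 q-prime refl
  ...   | inj₂ refl = ℕP.<-irrefl refl q<r

divisors : List ℕ → List ℕ
divisors []       = 1 ∷ []
divisors (q ∷ ps) = divisors ps ++ map (q ℕ.*_) (divisors ps)

∈divisors⇒∣ : ∀ ps {e} → e ∈ divisors ps → e ∣ product ps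
∈divisors⇒∣ []       (here refl) = ∣-refl
∈divisors⇒∣ (q ∷ ps) e∈ with ∈-++⁻ (divisors ps) e∈
... | inj₁ e∈ps = ∣n⇒∣m*n q (∈divisors⇒∣ ps e∈ps)
... | inj₂ e∈qps with ∈-map⁻ (q ℕ.*_) e∈qps
...   | f , f∈ps , refl = *-monoʳ-∣ q (∈divisors⇒∣ ps f∈ps)

prime∤⇒coprime : ∀ {q f} → Prime q → ¬ q ∣ f → Coprime f q
prime∤⇒coprime q-prime q∤f (d∣f , d∣q) with prime⇒irreducible q-prime d∣q
... | inj₁ d≡1 = d≡1
... | inj₂ refl = ⊥-elim (q∤f d∣f)

∣q*⇒∣ : ∀ {q f e} → Prime q → ¬ q ∣ f → f ∣ q ℕ.* e → f ∣ e
∣q*⇒∣ q-prime q∤f = coprime-divisor (prime∤⇒coprime q-prime q∤f)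

q*∣q*⇒∣ : ∀ {q f e} → Prime q → q ℕ.* f ∣ q ℕ.* e → f ∣ e
q*∣q*⇒∣ {suc q} _ = *-cancelˡ-∣ (suc q)

quot-q* : ∀ {q} e → Prime q → quot (q ℕ.* e) q ≡ e
quot-q* {suc q} e _ = trans (cong (_/ suc q) (ℕP.*-comm (suc q) e)) (m*n/n≡m e (suc q))

∣⇒∈divisors : ∀ ps → DistinctPrimes ps → ∀ {b} → b ∣ product ps → b ∈ divisors ps
∣⇒∈divisors []       _                    b∣1 rewrite ∣1⇒≡1 b∣1 = here refl
∣⇒∈divisors (q ∷ ps) (q-prime , q∤ps , ps-distinct) {b} b∣qps with q ∣? b
... | no  q∤b              = ∈-++⁺ˡ (∣⇒∈divisors ps ps-distinct (∣q*⇒∣ q-prime q∤b b∣qps))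
... | yes (divides k refl) = ∈-++⁺ʳ (divisors ps) (subst (_∈ map (q ℕ.*_) (divisors ps)) (ℕP.*-comm q k)
      (∈-map⁺ (q ℕ.*_) (∣⇒∈divisors ps ps-distinct (q*∣q*⇒∣ q-prime (subst (_∣ q ℕ.* product ps) (ℕP.*-comm k q) b∣qps)))))

divisor≢0 : ∀ ps → DistinctPrimes ps → ∀ {e} → e ∈ divisors ps → e ≢ 0
divisor≢0 ps ps-distinct e∈ refl = product≢0 ps ps-distinct (0∣⇒≡0 (∈divisors⇒∣ ps e∈))
  where
  product≢0 : ∀ ps → DistinctPrimes ps → product ps ≢ 0
  product≢0 []       _                        ()
  product≢0 (q ∷ ps) (q-prime , _ , distinct) e with ℕP.m*n≡0⇒m≡0∨n≡0 q e
  ... | inj₁ q≡0 = ≢-nonZero⁻¹ q {{prime⇒nonZero q-prime}} q≡0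
  ... | inj₂ ps≡0 = product≢0 ps distinct ps≡0

quotients : ∀ L {A B : ℕ → Poly} → (∀ {d} → d ∈ L → A d ∣ₓ B d) →
            Σ (ℕ → Poly) λ Q → ∀ {d} → d ∈ L → B d ≈ Q d *ₚ A d
quotients L {A} {B} A∣B = Q , spec
  where
  Q : ℕ → Poly
  Q d with d ∈? L
  ... | yes d∈L with A∣B d∈L
  ...   | q , _ = q
  Q d | no _ = []     -- irrelevant outside L
  spec : ∀ {d} → d ∈ L → B d ≈ Q d *ₚ A d
  spec {d} d∈L with d ∈? L
  ... | yes d∈L′ with A∣B d∈L′
  ...   | _ , qA≈B = ≈-sym qA≈B
  spec {d} d∈L | no d∉L = ⊥-elim (d∉L d∈L)

-- A cyclotomic family for n = ∏ ps: polynomials Φ_d, d ∣ n, with x^c - 1 = ∏_{d ∣ c} Φ_d for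
-- every c ∣ n, such that moreover Φ_d divides Φ_d(x^p) for every prime p ∤ n.
-- (Φ_d is the d-th cyclotomic polynomial, but only these two properties are used.)
record CyclotomicFamily (ps : List ℕ) : Set where
  field
    Φ             : ℕ → Poly
    factorises    : ∀ {c} → c ∈ divisors ps → X c ≈ divisorProduct (divisors ps) Φ c
    divides-subst : ∀ {p} → Prime p → ¬ p ∣ product ps → ∀ {d} → d ∈ divisors ps → Φ d ∣ₓ Φ d [x^ p ]

module Factorisation {ps} (distinct : DistinctPrimes ps) (Φ : ℕ → Poly)
                     (factorises : ∀ {c} → c ∈ divisors ps → X c ≈ divisorProduct (divisors ps) Φ c) where

  X-nonzeroConstant′ : ∀ {e} → e ∈ divisors ps → NonzeroConstant (X e)
  X-nonzeroConstant′ {zero}  e∈ = ⊥-elim (divisor≢0 ps distinct e∈ refl)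
  X-nonzeroConstant′ {suc e} e∈ = X-nonzeroConstant e

  Φ-nonzeroConstant : ∀ {d} → d ∈ divisors ps → NonzeroConstant (Φ d)
  Φ-nonzeroConstant d∈ = nonzeroConstant-divisor
    (∣ʳ-respʳ-≈ (≈-sym (factorises d∈)) (factor∣divisorProduct (divisors ps) Φ d∈ ∣-refl))
    (X-nonzeroConstant′ d∈)

  -- If Φ_d(x^p) = Ψ_d Φ_d for all d ∣ n, then G_p(x^e) = ∏_{d ∣ e} Ψ_d; in particular Ψ_e ∣ G_p(x^e).
  module _ {p} (Ψ : ℕ → Poly) (split : ∀ {d} → d ∈ divisors ps → Φ d [x^ p ] ≈ Ψ d *ₚ Φ d) where

    X-subst : ∀ {e} → e ∈ divisors ps → X e [x^ p ] ≈ divisorProduct (divisors ps) Ψ e *ₚ X e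
    X-subst {e} e∈ = begin
      X e [x^ p ]                                           ≈⟨ subst-cong p (factorises e∈) ⟩
      divisorProduct (divisors ps) Φ e [x^ p ]              ≈⟨ divisorProduct-subst (divisors ps) Φ Ψ p split e ⟩
      divisorProduct (divisors ps) Ψ e *ₚ divisorProduct (divisors ps) Φ e
                                                            ≈⟨ *-congˡ (divisorProduct (divisors ps) Ψ e) (≈-sym (factorises e∈)) ⟩
      divisorProduct (divisors ps) Ψ e *ₚ X e               ∎

    quotient∣G : ∀ {e} → e ∈ divisors ps → Ψ e ∣ₓ G p [x^ e ]
    quotient∣G {e} e∈ = ∣ʳ-respʳ-≈ (≈-sym G[x^e]≈) (factor∣divisorProduct (divisors ps) Ψ e∈ ∣-refl)
      where
      G[x^e]≈ : G p [x^ e ] ≈ divisorProduct (divisors ps) Ψ e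
      G[x^e]≈ = cancel (X e) _ _ (X-nonzeroConstant′ e∈) (begin
        X e *ₚ G p [x^ e ]                         ≈⟨ ≈-sym (X-factor e p) ⟩
        X (e ℕ.* p)                                ≈⟨ ≡⇒≈ (cong X (ℕP.*-comm e p)) ⟩
        X (p ℕ.* e)                                ≈⟨ ≈-sym (subst-X p e) ⟩
        X e [x^ p ]                                ≈⟨ X-subst e∈ ⟩
        divisorProduct (divisors ps) Ψ e *ₚ X e    ≈⟨ *-comm _ (X e) ⟩
        X e *ₚ divisorProduct (divisors ps) Ψ e    ∎)

trivialFamily : CyclotomicFamily []
trivialFamily = record { Φ = λ _ → X 1 ; factorises = factorises ; divides-subst = divides-subst }
  where
  factorises : ∀ {c} → c ∈ divisors [] → X c ≈ divisorProduct (divisors []) (λ _ → X 1) c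
  factorises (here refl) = ≈-sym (≈-trans (*-identityʳ _) (*-identityʳ _))
  divides-subst : ∀ {p} → Prime p → ¬ p ∣ 1 → ∀ {d} → d ∈ divisors [] → X 1 ∣ₓ X 1 [x^ p ]
  divides-subst {p} _ _ (here refl) = G p , ≈-sym (begin
    X 1 [x^ p ]    ≈⟨ subst-X p 1 ⟩
    X (p ℕ.* 1)    ≈⟨ ≡⇒≈ (cong X (ℕP.*-identityʳ p)) ⟩
    X p            ≈⟨ X≈X1*G p ⟩
    X 1 *ₚ G p     ≈⟨ *-comm (X 1) (G p) ⟩
    G p *ₚ X 1     ∎)

-- Passing from n to q·n for a prime q ∤ n: keep Φ_d for d ∣ n and put Φ_{qd} = Φ_d(x^q)/Φ_d.
module Extension {q ps} (q-prime : Prime q) (q∤n : ¬ q ∣ product ps) (distinct : DistinctPrimes ps)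
                 (family : CyclotomicFamily ps) where
  open CyclotomicFamily family
  open Factorisation distinct Φ factorises

  D : List ℕ
  D = divisors ps

  q∤divisor : ∀ {f} → f ∈ D → ¬ q ∣ f
  q∤divisor f∈ q∣f = q∤n (∣-trans q∣f (∈divisors⇒∣ ps f∈))

  Ψ : ℕ → Poly
  Ψ = proj₁ (quotients D (divides-subst q-prime q∤n))

  split : ∀ {d} → d ∈ D → Φ d [x^ q ] ≈ Ψ d *ₚ Φ d
  split = proj₂ (quotients D (divides-subst q-prime q∤n))

  Φ′ : ℕ → Poly
  Φ′ m with q ∣? m
  ... | yes _ = Ψ (quot m q)
  ... | no  _ = Φ m

  Φ′-old : ∀ {m} → ¬ q ∣ m → Φ′ m ≡ Φ m
  Φ′-old {m} q∤m with q ∣? m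
  ... | yes q∣m = ⊥-elim (q∤m q∣m)
  ... | no  _   = refl

  Φ′-new : ∀ e → Φ′ (q ℕ.* e) ≡ Ψ e
  Φ′-new e with q ∣? (q ℕ.* e)
  ... | yes _   = cong Ψ (quot-q* e q-prime)
  ... | no  q∤ = ⊥-elim (q∤ (m∣m*n e))

  divisorProduct-split : ∀ c → divisorProduct (divisors (q ∷ ps)) Φ′ c
                               ≈ divisorProduct D Φ′ c *ₚ ∏ D (λ f → Φ′ (q ℕ.* f) ^ ⟦ q ℕ.* f ∣ c ⟧)
  divisorProduct-split c = ≈-trans (∏-++ D (map (q ℕ.*_) D) (λ f → Φ′ f ^ ⟦ f ∣ c ⟧))
                                   (*-congˡ (divisorProduct D Φ′ c) (∏-map D (q ℕ.*_) (λ f → Φ′ f ^ ⟦ f ∣ c ⟧)))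

  old-part : ∀ c c′ → (∀ {f} → f ∈ D → f ∣ c → f ∣ c′) → (∀ {f} → f ∈ D → f ∣ c′ → f ∣ c) →
             divisorProduct D Φ c ≈ divisorProduct D Φ′ c′
  old-part c c′ to from = ∏-cong D (λ {f} f∈ → ≡⇒≈ (cong₂ _^_ (sym (Φ′-old (q∤divisor f∈))) (⟦∣⟧-cong (to f∈) (from f∈))))

  -- (★) for q·n: for c ∣ n the new factors do not occur, and for c = q·e it follows from
  -- x^(qe) - 1 = (x^e - 1)(x^q) = ∏_{f ∣ e} Ψ_f · ∏_{f ∣ e} Φ_f.
  factorises′ : ∀ {c} → c ∈ divisors (q ∷ ps) → X c ≈ divisorProduct (divisors (q ∷ ps)) Φ′ c
  factorises′ {c} c∈ with ∈-++⁻ D c∈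
  ... | inj₁ c∈D = begin
    X c                                                       ≈⟨ factorises c∈D ⟩
    divisorProduct D Φ c                                      ≈⟨ old-part c c (λ _ → id) (λ _ → id) ⟩
    divisorProduct D Φ′ c                                     ≈⟨ ≈-sym (*-identityʳ _) ⟩
    divisorProduct D Φ′ c *ₚ 1ₚ                               ≈⟨ *-congˡ (divisorProduct D Φ′ c) (≈-sym (∏-1 D _ new-exponent-0)) ⟩
    divisorProduct D Φ′ c *ₚ ∏ D (λ f → Φ′ (q ℕ.* f) ^ ⟦ q ℕ.* f ∣ c ⟧) ≈⟨ ≈-sym (divisorProduct-split c) ⟩
    divisorProduct (divisors (q ∷ ps)) Φ′ c                   ∎
    where
    new-exponent-0 : ∀ {f} → f ∈ D → Φ′ (q ℕ.* f) ^ ⟦ q ℕ.* f ∣ c ⟧ ≈ 1ₚ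
    new-exponent-0 _ = ≡⇒≈ (cong (Φ′ (q ℕ.* _) ^_) (⟦∣⟧≡0 (λ qf∣c → q∤divisor c∈D (∣-trans (m∣m*n _) qf∣c))))
  ... | inj₂ c∈qD with ∈-map⁻ (q ℕ.*_) c∈qD
  ...   | e , e∈D , refl = begin
    X (q ℕ.* e)                                               ≈⟨ ≈-sym (subst-X q e) ⟩
    X e [x^ q ]                                               ≈⟨ X-subst Ψ split e∈D ⟩
    divisorProduct D Ψ e *ₚ X e                               ≈⟨ *-congˡ (divisorProduct D Ψ e) (factorises e∈D) ⟩
    divisorProduct D Ψ e *ₚ divisorProduct D Φ e              ≈⟨ *-cong new-part (old-part e (q ℕ.* e) (λ _ → ∣n⇒∣m*n q) (λ f∈ → ∣q*⇒∣ q-prime (q∤divisor f∈))) ⟩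
    ∏ D (λ f → Φ′ (q ℕ.* f) ^ ⟦ q ℕ.* f ∣ q ℕ.* e ⟧) *ₚ divisorProduct D Φ′ (q ℕ.* e)
      ≈⟨ *-comm (∏ D (λ f → Φ′ (q ℕ.* f) ^ ⟦ q ℕ.* f ∣ q ℕ.* e ⟧)) (divisorProduct D Φ′ (q ℕ.* e)) ⟩
    divisorProduct D Φ′ (q ℕ.* e) *ₚ ∏ D (λ f → Φ′ (q ℕ.* f) ^ ⟦ q ℕ.* f ∣ q ℕ.* e ⟧) ≈⟨ ≈-sym (divisorProduct-split (q ℕ.* e)) ⟩
    divisorProduct (divisors (q ∷ ps)) Φ′ (q ℕ.* e)           ∎
    where
    new-part : divisorProduct D Ψ e ≈ ∏ D (λ f → Φ′ (q ℕ.* f) ^ ⟦ q ℕ.* f ∣ q ℕ.* e ⟧)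
    new-part = ∏-cong D (λ {f} _ → ≡⇒≈ (cong₂ _^_ (sym (Φ′-new f)) (⟦∣⟧-cong (*-monoʳ-∣ q) (q*∣q*⇒∣ q-prime))))

  ∤-left : ∀ {p} → ¬ p ∣ product (q ∷ ps) → ¬ p ∣ q
  ∤-left p∤qn p∣q = p∤qn (∣m⇒∣m*n (product ps) p∣q)

  ∤-right : ∀ {p} → ¬ p ∣ product (q ∷ ps) → ¬ p ∣ product ps
  ∤-right p∤qn p∣n = p∤qn (∣n⇒∣m*n q p∣n)

  -- For d = q·e this is the key lemma applied to A = Φ_e.
  divides-subst′ : ∀ {p} → Prime p → ¬ p ∣ product (q ∷ ps) → ∀ {d} → d ∈ divisors (q ∷ ps) → Φ′ d ∣ₓ Φ′ d [x^ p ]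
  divides-subst′ {p} p-prime p∤qn {d} d∈ with ∈-++⁻ D d∈
  ... | inj₁ d∈D = subst (λ t → t ∣ₓ t [x^ p ]) (sym (Φ′-old (q∤divisor d∈D))) (divides-subst p-prime (∤-right p∤qn) d∈D)
  ... | inj₂ d∈qD with ∈-map⁻ (q ℕ.*_) d∈qD
  ...   | e , e∈D , refl = subst (λ t → t ∣ₓ t [x^ p ]) (sym (Φ′-new e))
          (quotient∣subst p q (Φ-nonzeroConstant e∈D) (split e∈D) (split-p e∈D) comaximal)
    where
    Ψp : ℕ → Poly
    Ψp = proj₁ (quotients D (divides-subst p-prime (∤-right p∤qn)))
    split-p : ∀ {d} → d ∈ D → Φ d [x^ p ] ≈ Ψp d *ₚ Φ d
    split-p = proj₂ (quotients D (divides-subst p-prime (∤-right p∤qn)))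
    -- Ψ_e ∣ G_q(x^e) and Ψp_e ∣ G_p(x^e), which are comaximal as gcd(p, q) = 1
    comaximal : Comaximal (Ψ e) (Ψp e)
    comaximal = comaximal-divisors (comaximal-subst e (geometric-comaximal q p (prime∤⇒coprime p-prime (∤-left p∤qn))))
                                   (quotient∣G Ψ split e∈D) (quotient∣G Ψp split-p e∈D)

  family′ : CyclotomicFamily (q ∷ ps)
  family′ = record { Φ = Φ′ ; factorises = factorises′ ; divides-subst = divides-subst′ }

cyclotomicFamily : ∀ ps → DistinctPrimes ps → CyclotomicFamily ps
cyclotomicFamily []       _                             = trivialFamily
cyclotomicFamily (q ∷ ps) (q-prime , q∤n , distinct) =
  Extension.family′ q-prime q∤n distinct (cyclotomicFamily ps distinct)

mult-witness : ∀ C f → mult C f ≡ 0 ⊎ ∃ λ b → b ∈ C × f ∣ b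
mult-witness []      f = inj₁ refl
mult-witness (c ∷ C) f with f ∣? c
... | yes f∣c = inj₂ (c , here refl , f∣c)
... | no  _ with mult-witness C f
...   | inj₁ none           = inj₁ none
...   | inj₂ (b , b∈ , f∣b) = inj₂ (b , there b∈ , f∣b)

mult-≤ : ∀ C C′ → (∀ f {b} → b ∈ C → f ∣ b → mult C f ≤ mult C′ f) → ∀ f → mult C f ≤ mult C′ f
mult-≤ C C′ compare f with mult-witness C f
... | inj₁ none             = subst (_≤ mult C′ f) (sym none) z≤n
... | inj₂ (_ , b∈ , f∣b)   = compare f b∈ f∣b

^-∣ : ∀ p {a b} → a ≤ b → p ^ a ∣ₓ p ^ b
^-∣ p {a} {b} a≤b = ∣ʳ-respʳ-≈ (≈-trans (≈-sym (^-homo-* p a (b ℕ.∸ a))) (^-congʳ p (ℕP.m+[n∸m]≡n a≤b))) (x∣xy (p ^ a) (p ^ (b ℕ.∸ a)))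

module _ {ps} (family : CyclotomicFamily ps) where
  open CyclotomicFamily family

  F-factorises : ∀ C → (∀ {c} → c ∈ C → c ∈ divisors ps) → F C ≈ ∏ (divisors ps) (λ f → Φ f ^ mult C f)
  F-factorises []      _  = ≈-sym (∏-1 (divisors ps) _ (λ _ → ≈-refl))
  F-factorises (c ∷ C) C⊆ = begin
    X c *ₚ F C
      ≈⟨ *-cong (factorises (C⊆ (here refl))) (F-factorises C (λ c∈ → C⊆ (there c∈))) ⟩
    divisorProduct (divisors ps) Φ c *ₚ ∏ (divisors ps) (λ f → Φ f ^ mult C f)
      ≈⟨ ≈-sym (∏-* (divisors ps) (λ f → Φ f ^ ⟦ f ∣ c ⟧) (λ f → Φ f ^ mult C f)) ⟩
    ∏ (divisors ps) (λ f → Φ f ^ ⟦ f ∣ c ⟧ *ₚ Φ f ^ mult C f)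
      ≈⟨ ∏-cong (divisors ps) (λ {f} _ → ≈-trans (≈-sym (^-homo-* (Φ f) ⟦ f ∣ c ⟧ (mult C f))) (^-congʳ (Φ f) (sym (mult-∷ c C f)))) ⟩
    ∏ (divisors ps) (λ f → Φ f ^ mult (c ∷ C) f) ∎

  F-∣ : ∀ C C′ → (∀ {c} → c ∈ C → c ∈ divisors ps) → (∀ {c} → c ∈ C′ → c ∈ divisors ps) →
        (∀ f → mult C f ≤ mult C′ f) → F C ∣ₓ F C′
  F-∣ C C′ C⊆ C′⊆ fewer =
    ∣ʳ-respˡ-≈ (≈-sym (F-factorises C C⊆)) (∣ʳ-respʳ-≈ (≈-sym (F-factorises C′ C′⊆))
      (∏-∣ (divisors ps) _ _ (λ {f} _ → ^-∣ (Φ f) (fewer f))))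

mainTheorem9 : (ps : List ℕ) → Linked _<_ ps → All (λ p → Prime p × ¬ (2 ∣ p)) ps →
    (n : ℕ) → n ≡ product ps →
    (B : List ℕ) → Unique B → All (λ d → d ∣ n) B →
    (s : Sign) →
    (∀ d b → b ∈ B → d ∣ b → countMult n s B d ≥ countMult n (opp s) B d) →
    F (Bsgn n (opp s) B) ∣ₚ F (Bsgn n s B)
mainTheorem9 ps increasing odd-primes n refl B _ B∣n s balanced =
  ∣ₓ⇒∣ₚ (F-∣ (cyclotomicFamily ps distinct) (Bsgn n (opp s) B) (Bsgn n s B)
              (⊆divisors (opp s)) (⊆divisors s) (mult-≤ (Bsgn n (opp s) B) (Bsgn n s B) fewer))
  where
  distinct : DistinctPrimes ps
  distinct = increasing⇒distinct ps increasing (All.map proj₁ odd-primes)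
  ⊆B : ∀ t {b} → b ∈ Bsgn n t B → b ∈ B
  ⊆B t b∈ = proj₁ (∈-filter⁻ (λ d → hasSign n t d 𝔹.≟ 𝔹.true) b∈)
  ⊆divisors : ∀ t {b} → b ∈ Bsgn n t B → b ∈ divisors ps
  ⊆divisors t b∈ = ∣⇒∈divisors ps distinct (All.lookup B∣n (⊆B t b∈))
  fewer : ∀ f {b} → b ∈ Bsgn n (opp s) B → f ∣ b → mult (Bsgn n (opp s) B) f ≤ mult (Bsgn n s B) f
  fewer f b∈ f∣b = balanced f _ (⊆B (opp s) b∈) f∣b
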